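{- For every positive integer $p$, there exists a $7p$-colourable $P_5$-free graph $G$ that is not $8p$-mixing, i.e., the reconfiguration graph $\mathcal{R}_{8p}(G)$ is disconnected.
   Context: All graphs are finite and simple. For a positive integer $k$, a $k$-colouring of a graph $G$ is a map $\alpha\colon V(G)\to\{1,\dots,k\}$ with $\alpha(u)\neq\alpha(v)$ for every edge $uv$; $G$ is $k$-colourable if it has a $k$-colouring. The reconfiguration graph $\mathcal{R}_k(G)$ has as vertices the $k$-colourings of $G$, two colourings being adjacent if they differ in colour on exactly one vertex of $G$. $G$ is $k$-mixing if $\mathcal{R}_k(G)$ is connected. $P_5$ denotes the path on $5$ vertices, and $G$ is $P_5$-free if it has no induced subgraph isomorphic to $P_5$. -}

module Defs where

open import Data.Nat using (ℕ; suc; _≡ᵇ_)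
open import Data.Bool using (Bool; true; false)
open import Data.Fin using (Fin; toℕ)
open import Data.Product using (Σ; ∃; _×_; proj₁)
open import Relation.Binary.PropositionalEquality using (_≡_; _≢_)
open import Relation.Binary.Construct.Closure.ReflexiveTransitive using (Star)
open import Relation.Nullary using (¬_)
open import Function.Definitions using (Injective)

record Graph : Set where
  field
    n      : ℕ
    adj    : Fin n → Fin n → Bool
    sym    : ∀ u v → adj u v ≡ adj v u
    irrefl : ∀ v → adj v v ≡ false
open Graph public

IsColouring : (G : Graph) (k : ℕ) → (Fin (n G) → Fin k) → Set
IsColouring G k α = ∀ u v → adj G u v ≡ true → α u ≢ α v

Colouring : Graph → ℕ → Set
Colouring G k = Σ (Fin (n G) → Fin k) (IsColouring G k)

Colourable : Graph → ℕ → Set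
Colourable G k = Colouring G k

RAdj : (G : Graph) (k : ℕ) → Colouring G k → Colouring G k → Set
RAdj G k α β =
  ∃ λ v → (proj₁ α v ≢ proj₁ β v) × (∀ w → w ≢ v → proj₁ α w ≡ proj₁ β w)

Mixing : Graph → ℕ → Set
Mixing G k = ∀ (α β : Colouring G k) → Star (RAdj G k) α β

absDiff : ℕ → ℕ → ℕ
absDiff 0 m = m
absDiff (suc k) 0 = suc k
absDiff (suc k) (suc m) = absDiff k m

p5adj : Fin 5 → Fin 5 → Bool
p5adj i j = absDiff (toℕ i) (toℕ j) ≡ᵇ 1

InducedP5 : Graph → Set
InducedP5 G = Σ (Fin 5 → Fin (n G)) λ f →
  Injective _≡_ _≡_ f × (∀ i j → adj G (f i) (f j) ≡ p5adj i j)

P5Free : Graph → Set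
P5Free G = ¬ InducedP5 G

{-# OPTIONS --safe #-}
-- Call a k-colouring frozen if every vertex sees all k − 1 other colours on its neighbours: no
-- single vertex can then be recoloured, so the colouring is an isolated vertex of R_k(G) and
-- G is not k-mixing as soon as it has another k-colouring. The complement of L(S(K₄)) joined
-- with K₂ is a 14-vertex P₅-free graph H with a frozen 8-colouring and a 6-colouring (both
-- checked by exhaustive search). In the join of p copies of H colour counts multiply by p,
-- frozen colourings stay frozen, and P₅-freeness survives because the complement of P₅ is
-- connected.
module Submission where

open import Defs hiding (sym)
open import Data.Nat using (ℕ; suc; _*_; _≤_)
open import Data.Nat.Properties using (m≤m+n)
open import Data.Bool using (Bool; true; false; not; _∧_; _∨_)
open import Data.Bool.Properties using (∧-conicalˡ; ∧-conicalʳ; ∨-conicalˡ) renaming (_≟_ to _≟ᵇ_)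
open import Data.Empty using (⊥-elim)
open import Data.Fin using (Fin; zero; #_; combine; remQuot; inject≤)
open import Data.Fin.Properties
  using (_≟_; all?; any?; remQuot-combine; combine-surjective; combine-injectiveˡ; combine-injectiveʳ; inject≤-injective)
open import Data.Product using (∃; _×_; _,_; proj₁; proj₂)
open import Data.Sum using (_⊎_; inj₁; inj₂; [_,_])
open import Data.Vec using ([]; _∷_; lookup)
open import Relation.Binary.PropositionalEquality using (_≡_; _≢_; refl; sym; trans; cong; cong₂; subst; ≢-sym; module ≡-Reasoning)
open import Relation.Binary.Construct.Closure.ReflexiveTransitive using (ε; _◅_)
open import Relation.Nullary using (¬_; Dec; yes; no; does; ¬?; _→-dec_; _×-dec_)
open import Relation.Nullary.Decidable using (from-yes)

private
  variable
    a b k m : ℕ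

_≢ᵇ_ : Fin m → Fin m → Bool
i ≢ᵇ j = not (does (i ≟ j))

≢ᵇ-sym : (i j : Fin m) → (i ≢ᵇ j) ≡ (j ≢ᵇ i)
≢ᵇ-sym i j with i ≟ j | j ≟ i
... | yes _    | yes _   = refl
... | no _     | no _    = refl
... | yes i≡j  | no j≢i  = ⊥-elim (j≢i (sym i≡j))
... | no i≢j   | yes j≡i = ⊥-elim (i≢j (sym j≡i))

≢ᵇ-irrefl : (i : Fin m) → (i ≢ᵇ i) ≡ false
≢ᵇ-irrefl i with i ≟ i
... | yes _   = refl
... | no i≢i  = ⊥-elim (i≢i refl)

≢ᵇ⇒≢ : {i j : Fin m} → (i ≢ᵇ j) ≡ true → i ≢ j
≢ᵇ⇒≢ {i = i} {j} e with i ≟ j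
≢ᵇ⇒≢ () | yes _
... | no i≢j = i≢j

≢⇒≢ᵇ : {i j : Fin m} → i ≢ j → (i ≢ᵇ j) ≡ true
≢⇒≢ᵇ {i = i} {j} i≢j with i ≟ j
... | yes i≡j = ⊥-elim (i≢j i≡j)
... | no _    = refl

≢ᵇ-false⇒≡ : {i j : Fin m} → (i ≢ᵇ j) ≡ false → i ≡ j
≢ᵇ-false⇒≡ {i = i} {j} e with i ≟ j
... | yes i≡j = i≡j
≢ᵇ-false⇒≡ () | no _

∨-true⇒ : ∀ {x y} → x ∨ y ≡ true → x ≡ true ⊎ y ≡ true
∨-true⇒ {true}  _ = inj₁ refl
∨-true⇒ {false} e = inj₂ e

Edge : (G : Graph) → Fin (n G) → Fin (n G) → Set
Edge G u v = adj G u v ≡ true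

NonEdge : (G : Graph) → Fin (n G) → Fin (n G) → Set
NonEdge G u v = adj G u v ≡ false

edge? : (G : Graph) → ∀ u v → Dec (Edge G u v)
edge? G u v = adj G u v ≟ᵇ true

nonEdge? : (G : Graph) → ∀ u v → Dec (NonEdge G u v)
nonEdge? G u v = adj G u v ≟ᵇ false

weakenColouring : {G : Graph} → m ≤ k → Colouring G m → Colouring G k
weakenColouring m≤k (α , proper) =
  (λ v → inject≤ (α v) m≤k) , λ u v uv eq → proper u v uv (inject≤-injective m≤k m≤k _ _ eq)

Frozen : (G : Graph) → (Fin (n G) → Fin k) → Set
Frozen {k} G α = ∀ v (c : Fin k) → c ≢ α v → ∃ λ w → Edge G v w × α w ≡ c

frozen? : (G : Graph) (α : Fin (n G) → Fin k) → Dec (Frozen G α)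
frozen? G α = all? λ v → all? λ c → ¬? (c ≟ α v) →-dec any? λ w → edge? G v w ×-dec (α w ≟ c)

frozen⇒surjective : {G : Graph} {α : Fin (n G) → Fin k} → Frozen G α →
  Fin (n G) → ∀ c → ∃ λ w → α w ≡ c
frozen⇒surjective {α = α} frozen v c with c ≟ α v
... | yes c≡αv = v , sym c≡αv
... | no c≢αv  = let w , _ , αw≡c = frozen v c c≢αv in w , αw≡c

frozen⇒isolated : {G : Graph} (α β : Colouring G k) → Frozen G (proj₁ α) → ¬ RAdj G k α β
frozen⇒isolated {G = G} (α , _) (β , β-proper) frozen (v , αv≢βv , agree)
  with frozen v (β v) (≢-sym αv≢βv)
... | w , vw , αw≡βv = β-proper v w vw (trans (sym αw≡βv) (agree w w≢v))
  where
  w≢v : w ≢ v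
  w≢v refl with () ← trans (sym vw) (irrefl G w)

frozen⇒¬mixing : {G : Graph} (α β : Colouring G k) → Frozen G (proj₁ α) →
  (v : Fin (n G)) → proj₁ α v ≢ proj₁ β v → ¬ Mixing G k
frozen⇒¬mixing {G = G} α β frozen v αv≢βv mixing with mixing α β
... | ε       = αv≢βv refl
... | _◅_ {j = γ} step _ = frozen⇒isolated {G = G} α γ frozen step

NoInducedPath₅ : Graph → Set
NoInducedPath₅ G =
  ∀ u₀ u₁ → Edge G u₀ u₁ →
  ∀ u₂ → Edge G u₁ u₂ → NonEdge G u₀ u₂ →
  ∀ u₃ → Edge G u₂ u₃ → NonEdge G u₀ u₃ → NonEdge G u₁ u₃ →
  ∀ u₄ → Edge G u₃ u₄ → NonEdge G u₀ u₄ → NonEdge G u₁ u₄ → ¬ NonEdge G u₂ u₄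

noInducedPath₅? : (G : Graph) → Dec (NoInducedPath₅ G)
noInducedPath₅? G =
  all? λ u₀ → all? λ u₁ → edge? G u₀ u₁ →-dec
  all? λ u₂ → edge? G u₁ u₂ →-dec nonEdge? G u₀ u₂ →-dec
  all? λ u₃ → edge? G u₂ u₃ →-dec nonEdge? G u₀ u₃ →-dec nonEdge? G u₁ u₃ →-dec
  all? λ u₄ → edge? G u₃ u₄ →-dec nonEdge? G u₀ u₄ →-dec nonEdge? G u₁ u₄ →-dec ¬? (nonEdge? G u₂ u₄)

noInducedPath₅⇒P5Free : {G : Graph} → NoInducedPath₅ G → P5Free G
noInducedPath₅⇒P5Free noPath (f , _ , induced) =
  noPath (f (# 0)) (f (# 1)) (induced (# 0) (# 1))
    (f (# 2)) (induced (# 1) (# 2)) (induced (# 0) (# 2))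
    (f (# 3)) (induced (# 2) (# 3)) (induced (# 0) (# 3)) (induced (# 1) (# 3))
    (f (# 4)) (induced (# 3) (# 4)) (induced (# 0) (# 4)) (induced (# 1) (# 4)) (induced (# 2) (# 4))

-- The subgraph of the tensor product K_a × K_b induced by the labelling v ↦ (ρ v , κ v).
labelGraph : {N : ℕ} → (Fin N → Fin a) → (Fin N → Fin b) → Graph
labelGraph {N = N} ρ κ = record
  { n      = N
  ; adj    = λ u v → (ρ u ≢ᵇ ρ v) ∧ (κ u ≢ᵇ κ v)
  ; sym    = λ u v → cong₂ _∧_ (≢ᵇ-sym (ρ u) (ρ v)) (≢ᵇ-sym (κ u) (κ v))
  ; irrefl = λ v → subst (λ x → x ∧ (κ v ≢ᵇ κ v) ≡ false) (sym (≢ᵇ-irrefl (ρ v))) refl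
  }

module _ {N : ℕ} (ρ : Fin N → Fin a) (κ : Fin N → Fin b) where

  labelGraph-colouringˡ : Colouring (labelGraph ρ κ) a
  labelGraph-colouringˡ = ρ , λ u v uv → ≢ᵇ⇒≢ (∧-conicalˡ _ _ uv)

  labelGraph-colouringʳ : Colouring (labelGraph ρ κ) b
  labelGraph-colouringʳ = κ , λ u v uv → ≢ᵇ⇒≢ (∧-conicalʳ _ _ uv)

-- The join of p disjoint copies of H; combine v i is the vertex v of the i-th copy.
module JoinPower (H : Graph) (p : ℕ) where

  Vertex : Set
  Vertex = Fin (n H * p)

  loc : Vertex → Fin (n H)
  loc u = proj₁ (remQuot {n H} p u)

  copy : Vertex → Fin p
  copy u = proj₂ (remQuot {n H} p u)

  loc-combine : ∀ (v : Fin (n H)) (i : Fin p) → loc (combine v i) ≡ v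
  loc-combine v i = cong proj₁ (remQuot-combine v i)

  copy-combine : ∀ (v : Fin (n H)) (i : Fin p) → copy (combine v i) ≡ i
  copy-combine v i = cong proj₂ (remQuot-combine v i)

  joinPower : Graph
  joinPower = record
    { n      = n H * p
    ; adj    = λ u v → (copy u ≢ᵇ copy v) ∨ adj H (loc u) (loc v)
    ; sym    = λ u v → cong₂ _∨_ (≢ᵇ-sym (copy u) (copy v)) (Defs.sym H (loc u) (loc v))
    ; irrefl = λ v → subst (λ x → x ∨ adj H (loc v) (loc v) ≡ false) (sym (≢ᵇ-irrefl (copy v))) (irrefl H (loc v))
    }

  lift : (Fin (n H) → Fin k) → Vertex → Fin (k * p)
  lift α u = combine (α (loc u)) (copy u)

  lift-combine : (α : Fin (n H) → Fin k) (v : Fin (n H)) (i : Fin p) → lift α (combine v i) ≡ combine (α v) i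
  lift-combine α v i rewrite loc-combine v i | copy-combine v i = refl

  adj-sameCopy : ∀ u v → copy u ≡ copy v → adj joinPower u v ≡ adj H (loc u) (loc v)
  adj-sameCopy u v same rewrite same | ≢ᵇ-irrefl (copy v) = refl

  nonEdge⇒sameCopy : ∀ u v → NonEdge joinPower u v → copy u ≡ copy v
  nonEdge⇒sameCopy u v uv = ≢ᵇ-false⇒≡ (∨-conicalˡ _ _ uv)

  edge-otherCopy : ∀ u w (i : Fin p) → i ≢ copy u → Edge joinPower u (combine w i)
  edge-otherCopy u w i i≢ = cong (_∨ adj H (loc u) (loc (combine w i)))
    (≢⇒≢ᵇ (λ same → i≢ (trans (sym (copy-combine w i)) (sym same))))

  edge-sameCopy : ∀ u w → Edge H (loc u) w → Edge joinPower u (combine w (copy u))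
  edge-sameCopy u w uw = begin
    adj joinPower u (combine w (copy u))  ≡⟨ adj-sameCopy u _ (sym (copy-combine w (copy u))) ⟩
    adj H (loc u) (loc (combine w (copy u))) ≡⟨ cong (adj H (loc u)) (loc-combine w (copy u)) ⟩
    adj H (loc u) w                        ≡⟨ uw ⟩
    true                                   ∎
    where open ≡-Reasoning

  liftColouring : Colouring H k → Colouring joinPower (k * p)
  liftColouring {k} (α , proper) = lift α , λ u v uv same-colour →
    [ (λ copies-differ → ≢ᵇ⇒≢ copies-differ (combine-injectiveʳ {k} _ _ _ _ same-colour))
    , (λ loc-edge → proper _ _ loc-edge (combine-injectiveˡ {k} _ _ _ _ same-colour))
    ] (∨-true⇒ uv)

  frozen-lift : {α : Fin (n H) → Fin k} → Frozen H α → Frozen joinPower (lift α)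
  frozen-lift {k} {α} frozen u c c≢ with combine-surjective {k} {p} c
  ... | c₀ , i , refl with i ≟ copy u
  ...   | yes refl =
    let w , uw , αw≡c₀ = frozen (loc u) c₀ (λ c₀≡ → c≢ (cong (λ x → combine x i) c₀≡))
    in combine w i , edge-sameCopy u w uw , trans (lift-combine α w i) (cong (λ x → combine x i) αw≡c₀)
  ...   | no i≢ =
    let w , αw≡c₀ = frozen⇒surjective {G = H} frozen (loc u) c₀
    in combine w i , edge-otherCopy u w i i≢ , trans (lift-combine α w i) (cong (λ x → combine x i) αw≡c₀)

  joinPower-¬mixing : (α β : Colouring H k) → Frozen H (proj₁ α) →
    ∀ v → proj₁ α v ≢ proj₁ β v → Fin p → ¬ Mixing joinPower (k * p)
  joinPower-¬mixing {k} α β frozen v αv≢βv i =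
    frozen⇒¬mixing {G = joinPower} (liftColouring α) (liftColouring β) (frozen-lift frozen) (combine v i)
      (λ eq → αv≢βv (combine-injectiveˡ {k} _ _ _ _
        (trans (sym (lift-combine (proj₁ α) v i)) (trans eq (lift-combine (proj₁ β) v i)))))

  -- Non-adjacent vertices lie in one copy, and the complement of P₅ is connected.
  noInducedPath₅-joinPower : NoInducedPath₅ H → NoInducedPath₅ joinPower
  noInducedPath₅-joinPower noPath u₀ u₁ e₀₁ u₂ e₁₂ n₀₂ u₃ e₂₃ n₀₃ n₁₃ u₄ e₃₄ n₀₄ n₁₄ n₂₄ =
    noPath (loc u₀) (loc u₁) (inH refl c₁ e₀₁)
      (loc u₂) (inH c₁ c₂ e₁₂) (inH refl c₂ n₀₂)
      (loc u₃) (inH c₂ c₃ e₂₃) (inH refl c₃ n₀₃) (inH c₁ c₃ n₁₃)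
      (loc u₄) (inH c₃ c₄ e₃₄) (inH refl c₄ n₀₄) (inH c₁ c₄ n₁₄) (inH c₂ c₄ n₂₄)
    where
    inH : ∀ {u v x} → copy u ≡ copy u₀ → copy v ≡ copy u₀ → adj joinPower u v ≡ x → adj H (loc u) (loc v) ≡ x
    inH cu cv = trans (sym (adj-sameCopy _ _ (trans cu (sym cv))))
    c₂ : copy u₂ ≡ copy u₀
    c₂ = sym (nonEdge⇒sameCopy u₀ u₂ n₀₂)
    c₃ : copy u₃ ≡ copy u₀
    c₃ = sym (nonEdge⇒sameCopy u₀ u₃ n₀₃)
    c₄ : copy u₄ ≡ copy u₀
    c₄ = sym (nonEdge⇒sameCopy u₀ u₄ n₀₄)
    c₁ : copy u₁ ≡ copy u₀
    c₁ = trans (nonEdge⇒sameCopy u₁ u₃ n₁₃) c₃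

-- Vertices 0–11 are the edges of the subdivision S(K₄), labelled by the edge of K₄ they halve
-- and by their endpoint in K₄; two are adjacent iff they share no vertex of S(K₄), so they span
-- the complement of L(S(K₄)). Vertices 12 and 13 have fresh labels, hence are universal.
halvedEdge : Fin 14 → Fin 8
halvedEdge = lookup (# 0 ∷ # 0 ∷ # 1 ∷ # 1 ∷ # 2 ∷ # 2 ∷ # 3 ∷ # 3 ∷ # 4 ∷ # 4 ∷ # 5 ∷ # 5 ∷ # 6 ∷ # 7 ∷ [])

endpoint : Fin 14 → Fin 6
endpoint = lookup (# 0 ∷ # 1 ∷ # 0 ∷ # 2 ∷ # 0 ∷ # 3 ∷ # 1 ∷ # 2 ∷ # 1 ∷ # 3 ∷ # 2 ∷ # 3 ∷ # 4 ∷ # 5 ∷ [])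

H : Graph
H = labelGraph halvedEdge endpoint

H-frozen : Frozen H halvedEdge
H-frozen = from-yes (frozen? H halvedEdge)

H-noInducedPath₅ : NoInducedPath₅ H
H-noInducedPath₅ = from-yes (noInducedPath₅? H)

theorem1 : ∀ (p : ℕ) → 1 ≤ p →
    ∃ λ (G : Graph) → Colourable G (7 * p) × P5Free G × ¬ Mixing G (8 * p)
theorem1 p@(suc _) _ =
  joinPower ,
  liftColouring (weakenColouring {G = H} (m≤m+n 6 1) endpointColouring) ,
  noInducedPath₅⇒P5Free {G = joinPower} (noInducedPath₅-joinPower H-noInducedPath₅) ,
  joinPower-¬mixing halvedEdgeColouring (weakenColouring {G = H} (m≤m+n 6 2) endpointColouring)
    H-frozen (# 1) (λ ()) zero
  where
  open JoinPower H p
  halvedEdgeColouring : Colouring H 8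
  halvedEdgeColouring = labelGraph-colouringˡ halvedEdge endpoint
  endpointColouring : Colouring H 6
  endpointColouring = labelGraph-colouringʳ halvedEdge endpoint
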